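{- Let $d$ be a power of $2$, let $A,B$ be multisets of points of $\{0,1\}^d$ of equal size, and let $T$ be any quadtree. Then $\mathrm{Cost}(M)\le\mathrm{Value}_T(A,B)$ for every $M\in\mathcal{M}_T(A,B)$.
   Context: Let $h=\log_2(2d)$. A quadtree is a rooted tree $T$ of depth $h$; each internal node $v$ at depth $j<h$ is labelled with an ordered tuple $(i_1,\dots,i_{2^j})\in[d]^{2^j}$ and has $2^{2^j}$ children, one $(b_1,\dots,b_{2^j})$-child for each $(b_1,\dots,b_{2^j})\in\{0,1\}^{2^j}$; every node at depth $h-1$ is labelled $(1,\dots,d)$. A point $x\in\{0,1\}^d$ determines a root-to-leaf path $\mathsf{v}_0(x),\dots,\mathsf{v}_h(x)$: from a node at depth $j$ labelled $(i_1,\dots,i_{2^j})$ go to its $(x_{i_1},\dots,x_{i_{2^j}})$-child. For a node $v$ at depth $i$, $A_v=\{a\in A:\mathsf{v}_i(a)=v\}$, $B_v$ similarly, $C_v=A_v\cup B_v$ (multisets). For an edge $(u,v)$ ($u$ parent), $\mathrm{avg}_{u,v}=\mathbb{E}_{c\sim C_u,c'\sim C_v}\|c-c'\|_1$ (uniform), $0$ if $C_v=\emptyset$. $\mathrm{Value}_T(A,B)=\sum_{(u,v)\in E_T}\big||A_v|-|B_v|\big|\,\mathrm{avg}_{u,v}$. $\mathcal{M}_T(A,B)$ is the set of perfect matchings $M\subseteq A\times B$ maximizing $\sum_{(a,b)\in M}$ (depth of the least common ancestor of the leaves of $a$ and $b$). $\mathrm{Cost}(M)=\sum_{(a,b)\in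 M}\|a-b\|_1$. -}

module Defs where

open import Data.Bool using (Bool; true; false; _xor_; if_then_else_)
open import Data.Nat using (ℕ; zero; suc; _^_; ∣_-_∣; _≤_)
import Data.Nat as ℕ
open import Data.Fin using (Fin)
open import Data.Vec using (Vec; []; _∷_; map; lookup; allFin; zipWith; toList)
import Data.Vec as V
open import Data.Vec.Properties using (≡-dec)
open import Data.List using (List; []; _∷_; _++_; length; filter; concatMap)
import Data.List as L
import Data.Nat.ListAction as LA
open import Data.Integer using (+_)
open import Data.Rational using (ℚ; 0ℚ; _/_; _+_; _*_)
open import Data.Fin.Permutation using (Permutation′; _⟨$⟩ʳ_)
open import Relation.Nullary using (Dec; yes; no)
open import Relation.Binary.PropositionalEquality using (_≡_)
import Data.Bool as B

Point : ℕ → Set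
Point m = Vec Bool m

dist : ∀ {m} → Point m → Point m → ℕ
dist x y = V.sum (zipWith (λ a b → if a xor b then 1 else 0) x y)

allBits : (n : ℕ) → List (Vec Bool n)
allBits zero = [] ∷ []
allBits (suc n) = concatMap (λ v → (false ∷ v) ∷ (true ∷ v) ∷ []) (allBits n)

_≟v_ : ∀ {n} (x y : Vec Bool n) → Dec (x ≡ y)
_≟v_ = ≡-dec B._≟_

sel : ∀ {m l} → Vec (Fin m) l → Point m → Vec Bool l
sel ℓ x = map (lookup x) ℓ

-- Quadtrees for d = 2^k, depth h = k+1.
-- Tree k j r : subtree rooted at a node of depth j, with r more levels
-- below it (so j + r = h).
-- A node at depth h-1 = k is labelled (1,...,d) (constructor 'last');
-- its 2^d children are leaves (depth h), which carry no data.
data Tree (k : ℕ) : ℕ → ℕ → Set where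
  last : Tree k k 1
  node : ∀ {j r} → Vec (Fin (2 ^ k)) (2 ^ j)
       → (Vec Bool (2 ^ j) → Tree k (suc j) (suc r))
       → Tree k j (suc (suc r))

Quadtree : ℕ → Set
Quadtree k = Tree k 0 (suc k)

lastLabel : (k : ℕ) → Vec (Fin (2 ^ k)) (2 ^ k)
lastLabel k = allFin (2 ^ k)

goTo : ∀ {m l} → Vec (Fin m) l → Vec Bool l → List (Point m) → List (Point m)
goTo ℓ b = filter (λ x → sel ℓ x ≟v b)

toℚ : ℕ → ℚ
toℚ n = + n / 1

sumℚ : List ℚ → ℚ
sumℚ = L.foldr _+_ 0ℚ

divℚ : ℕ → ℕ → ℚ
divℚ s zero = 0ℚ
divℚ s (suc n) = + s / suc n

-- avg_{u,v} = E_{c ~ C_u, c' ~ C_v} ||c - c'||_1 (0 if C_v empty; then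
-- |C_u||C_v| = 0; if C_v is nonempty so is C_u ⊇ C_v)
avg : ∀ {m} → List (Point m) → List (Point m) → ℚ
avg Cu Cv = divℚ (LA.sum (L.map (λ c → LA.sum (L.map (λ c' → dist c c') Cv)) Cu))
                 (length Cu ℕ.* length Cv)

edgeTerm : ∀ {m} → (Au Bu Av Bv : List (Point m)) → ℚ
edgeTerm Au Bu Av Bv = toℚ ∣ length Av - length Bv ∣ * avg (Au ++ Bu) (Av ++ Bv)

valueT : ∀ {k j r} → Tree k j r → List (Point (2 ^ k)) → List (Point (2 ^ k)) → ℚ
valueT {k} last Au Bu =
  sumℚ (L.map (λ b → edgeTerm Au Bu (goTo (lastLabel k) b Au) (goTo (lastLabel k) b Bu))
              (allBits (2 ^ k)))
valueT {j = j} (node ℓ f) Au Bu =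
  sumℚ (L.map (λ b → edgeTerm Au Bu (goTo ℓ b Au) (goTo ℓ b Bu)
                      + valueT (f b) (goTo ℓ b Au) (goTo ℓ b Bu))
              (allBits (2 ^ j)))

Value : ∀ {k n} → Quadtree k → Vec (Point (2 ^ k)) n → Vec (Point (2 ^ k)) n → ℚ
Value T A B = valueT T (toList A) (toList B)

-- depth of the least common ancestor of the leaves of x and y,
-- in the subtree rooted at a node of depth j (depth counted from j)
lcaT : ∀ {k j r} → Tree k j r → Point (2 ^ k) → Point (2 ^ k) → ℕ
lcaT {k} last x y with sel (lastLabel k) x ≟v sel (lastLabel k) y
... | yes _ = 1
... | no _ = 0
lcaT (node ℓ f) x y with sel ℓ x ≟v sel ℓ y
... | yes _ = suc (lcaT (f (sel ℓ x)) x y)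
... | no _ = 0

-- Perfect matchings between multisets A, B of size n, given as indexed
-- families: a_i is matched to b_{σ(i)}.
lcaScore : ∀ {k n} → Quadtree k → Vec (Point (2 ^ k)) n → Vec (Point (2 ^ k)) n
         → Permutation′ n → ℕ
lcaScore {n = n} T A B σ = V.sum (map (λ i → lcaT T (lookup A i) (lookup B (σ ⟨$⟩ʳ i))) (allFin n))

IsOptimal : ∀ {k n} → Quadtree k → Vec (Point (2 ^ k)) n → Vec (Point (2 ^ k)) n
          → Permutation′ n → Set
IsOptimal T A B σ = ∀ τ → lcaScore T A B τ ≤ lcaScore T A B σ

Cost : ∀ {m n} → Vec (Point m) n → Vec (Point m) n → Permutation′ n → ℕ
Cost {n = n} A B σ = V.sum (map (λ i → dist (lookup A i) (lookup B (σ ⟨$⟩ʳ i))) (allFin n))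

module Submission where

-- For a node u, charge each pair of M matched inside the subtree of u its distance ‖a - b‖₁, and each
-- point x of C_u whose partner lies outside it the mean distance E_{c ~ C_u} ‖x - c‖₁. This potential is bounded
-- by the part of Value_T below u, by induction on the subtree. At u, a pair that splits pays
-- ‖a - b‖₁ ≤ E‖a - c‖₁ + E‖b - c‖₁, and a point leaving through child v pays
-- E_{C_u}‖x - c‖₁ ≤ avg_{u,v} + E_{C_v}‖x - c‖₁ (both are triangle inequalities averaged over c).
-- Since M maximises the total LCA depth, the points leaving a child v are all from A or all from B: an A-point
-- and a B-point leaving v could swap partners and deepen the matching. Hence there are exactly ||A_v| - |B_v||
-- of them, and together they pay the edge term of (u, v). At a leaf all points coincide and the potential
-- vanishes; at the root it is Cost(M).

open import Data.Nat as ℕ using (ℕ; zero; suc; _+_; _*_; _≤_; _<_; z≤n; s≤s; _^_)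
import Data.Nat.Properties as ℕ
open import Data.Nat.Tactic.RingSolver using (solve-∀)
import Data.Integer as ℤ
import Data.Integer.Properties as ℤ
open import Data.Rational as ℚ using (ℚ; 0ℚ; 1ℚ)
import Data.Rational.Properties as ℚ
open import Data.Rational.Unnormalised as ℚᵘ using (mkℚᵘ; *≤*)
import Data.Rational.Unnormalised.Properties as ℚᵘ
open import Data.Bool using (Bool; true; false; if_then_else_; _xor_)
open import Data.Vec as Vec using (Vec; []; _∷_)
open import Data.List as List using (List; []; _∷_; _++_; length; filter)
import Data.Nat.ListAction as ℕ
import Data.List.Properties as List
open import Data.List.Membership.Propositional using (_∈_)
open import Data.List.Membership.Propositional.Properties
  using (∈-filter⁻; ∈-filter⁺; ∈-++⁻; ∈-++⁺ˡ; ∈-++⁺ʳ; ∈-map⁺)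
open import Data.List.Relation.Binary.Permutation.Propositional
  using (_↭_; ↭-refl; ↭-trans; ↭-sym; ↭-reflexive; prep; module PermutationReasoning)
import Data.List.Relation.Binary.Permutation.Propositional.Properties as ↭
open import Data.List.Relation.Unary.Any using (here; there)
open import Algebra.Bundles using (CommutativeMonoid)
import Algebra.Properties.CommutativeSemigroup as CommSemigroupProperties
open import Data.Fin as Fin using (Fin)
import Data.Fin.Properties as Fin
open import Data.Fin.Permutation using (Permutation′; _⟨$⟩ʳ_; transpose; _∘ₚ_)
import Data.Fin.Permutation.Components as PC
open import Data.Vec.Functional using (updateAt)
open import Data.Vec.Functional.Properties using (updateAt-updates; updateAt-minimal)
import Data.Vec.Properties as Vec
open import Algebra.Properties.CommutativeMonoid.Sum ℕ.+-0-commutativeMonoid using (sum; sum-remove; sum-cong-≗)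
open import Data.Sum as Sum using (_⊎_; inj₁; inj₂)
open import Data.Product using (_×_; _,_; proj₁; proj₂)
open import Data.Unit using (⊤; tt)
open import Data.Empty using (⊥; ⊥-elim)
open import Relation.Nullary using (Dec; yes; no; does; ¬?; contradiction)
open import Relation.Unary using (Pred; Decidable)
open import Relation.Binary.PropositionalEquality
open import Function using (_∘_; _∘′_)

open import Defs

private
  module ℕ+ = CommSemigroupProperties ℕ.+-commutativeSemigroup
  module ℚ+ = CommSemigroupProperties (CommutativeMonoid.commutativeSemigroup ℚ.+-0-commutativeMonoid)

cross-≤⇒/-≤ : ∀ x y m n → x * suc n ≤ y * suc m → ℤ.+ x ℚ./ suc m ℚ.≤ ℤ.+ y ℚ./ suc n
cross-≤⇒/-≤ x y m n le = ℚ.toℚᵘ-cancel-≤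
  (ℚᵘ.≤-respˡ-≃ (ℚᵘ.≃-sym (ℚ.toℚᵘ-fromℚᵘ (mkℚᵘ (ℤ.+ x) m)))
  (ℚᵘ.≤-respʳ-≃ (ℚᵘ.≃-sym (ℚ.toℚᵘ-fromℚᵘ (mkℚᵘ (ℤ.+ y) n)))
  (*≤* (subst₂ ℤ._≤_ (ℤ.pos-* x (suc n)) (ℤ.pos-* y (suc m)) (ℤ.+≤+ le)))))

/-+ : ∀ x y m n → ℤ.+ x ℚ./ suc m ℚ.+ ℤ.+ y ℚ./ suc n ≡ ℤ.+ (x * suc n + y * suc m) ℚ./ (suc m * suc n)
/-+ x y m n = ℚ.toℚᵘ-injective (ℚᵘ.≃-trans (ℚ.toℚᵘ-homo-+ (ℤ.+ x ℚ./ suc m) (ℤ.+ y ℚ./ suc n))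
  (ℚᵘ.≃-trans (ℚᵘ.+-cong (ℚ.toℚᵘ-fromℚᵘ (mkℚᵘ (ℤ.+ x) m)) (ℚ.toℚᵘ-fromℚᵘ (mkℚᵘ (ℤ.+ y) n)))
  (ℚᵘ.≃-trans (ℚᵘ.≃-reflexive unnormalised) (ℚᵘ.≃-sym (ℚ.toℚᵘ-fromℚᵘ (mkℚᵘ _ _))))))
  where
  unnormalised : mkℚᵘ (ℤ.+ x) m ℚᵘ.+ mkℚᵘ (ℤ.+ y) n ≡ ℤ.+ (x * suc n + y * suc m) ℚᵘ./ (suc m * suc n)
  unnormalised = cong (ℚᵘ._/ (suc m * suc n))
    (trans (cong₂ ℤ._+_ (sym (ℤ.pos-* x (suc n))) (sym (ℤ.pos-* y (suc m))))
           (sym (ℤ.pos-+ (x * suc n) (y * suc m))))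

toℚ-+ : ∀ x y → toℚ (x + y) ≡ toℚ x ℚ.+ toℚ y
toℚ-+ x y = sym (trans (/-+ x y 0 0) (cong (λ z → ℤ.+ z ℚ./ 1) (cong₂ _+_ (ℕ.*-identityʳ x) (ℕ.*-identityʳ y))))

divℚ-zero : ∀ n → divℚ 0 n ℚ.≤ 0ℚ
divℚ-zero zero = ℚ.≤-refl
divℚ-zero (suc n) = cross-≤⇒/-≤ 0 0 n 0 z≤n

divℚ-≤-+ : ∀ x y z m n → suc n * x ≤ suc m * y + z →
           divℚ x (suc m) ℚ.≤ divℚ z (suc m * suc n) ℚ.+ divℚ y (suc n)
divℚ-≤-+ x y z m n le = subst (divℚ x (suc m) ℚ.≤_) (sym (/-+ z y (n + m * suc n) n))
  (cross-≤⇒/-≤ x (z * suc n + y * (suc m * suc n)) m (n + (n + m * suc n) * suc n)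
    (subst₂ _≤_ (lhs x m n) (rhs y z m n) (ℕ.*-monoˡ-≤ (suc m * suc n) le)))
  where
  lhs : ∀ x m n → suc n * x * (suc m * suc n) ≡ x * (suc m * suc n * suc n)
  lhs = solve-∀
  rhs : ∀ y z m n → (suc m * y + z) * (suc m * suc n) ≡ (z * suc n + y * (suc m * suc n)) * suc m
  rhs = solve-∀

toℚ-≤-divℚ-+ : ∀ d x y m → suc m * d ≤ x + y → toℚ d ℚ.≤ divℚ x (suc m) ℚ.+ divℚ y (suc m)
toℚ-≤-divℚ-+ d x y m le = subst (toℚ d ℚ.≤_) (sym (/-+ x y m m))
  (cross-≤⇒/-≤ d (x * suc m + y * suc m) 0 (m + m * suc m)
    (subst₂ _≤_ (lhs d m) (rhs x y m) (ℕ.*-monoˡ-≤ (suc m) le)))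
  where
  lhs : ∀ d m → suc m * d * suc m ≡ d * (suc m * suc m)
  lhs = solve-∀
  rhs : ∀ x y m → (x + y) * suc m ≡ (x * suc m + y * suc m) * 1
  rhs = solve-∀

∑ : ∀ {a} {X : Set a} → (X → ℚ) → List X → ℚ
∑ f xs = sumℚ (List.map f xs)

∑ℕ : ∀ {a} {X : Set a} → (X → ℕ) → List X → ℕ
∑ℕ f xs = ℕ.sum (List.map f xs)

module _ {a} {X : Set a} where

  ∑-++ : ∀ (f : X → ℚ) xs ys → ∑ f (xs ++ ys) ≡ ∑ f xs ℚ.+ ∑ f ys
  ∑-++ f [] ys = sym (ℚ.+-identityˡ _)
  ∑-++ f (x ∷ xs) ys = trans (cong (f x ℚ.+_) (∑-++ f xs ys)) (sym (ℚ.+-assoc (f x) _ _))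

  ∑-+ : ∀ (f g : X → ℚ) xs → ∑ (λ x → f x ℚ.+ g x) xs ≡ ∑ f xs ℚ.+ ∑ g xs
  ∑-+ f g [] = refl
  ∑-+ f g (x ∷ xs) = trans (cong (f x ℚ.+ g x ℚ.+_) (∑-+ f g xs)) (ℚ+.interchange (f x) (g x) _ _)

  ∑-mono-≤ : ∀ {f g : X → ℚ} xs → (∀ {x} → x ∈ xs → f x ℚ.≤ g x) → ∑ f xs ℚ.≤ ∑ g xs
  ∑-mono-≤ [] le = ℚ.≤-refl
  ∑-mono-≤ (x ∷ xs) le = ℚ.+-mono-≤ (le (here refl)) (∑-mono-≤ xs (le ∘′ there))

  ∑-cong : ∀ {f g : X → ℚ} xs → (∀ {x} → x ∈ xs → f x ≡ g x) → ∑ f xs ≡ ∑ g xs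
  ∑-cong [] eq = refl
  ∑-cong (x ∷ xs) eq = cong₂ ℚ._+_ (eq (here refl)) (∑-cong xs (eq ∘′ there))

  ∑-const : ∀ q (xs : List X) → ∑ (λ _ → q) xs ≡ toℚ (length xs) ℚ.* q
  ∑-const q [] = sym (ℚ.*-zeroˡ q)
  ∑-const q (x ∷ xs) = sym (begin
    toℚ (1 + length xs) ℚ.* q          ≡⟨ cong (ℚ._* q) (toℚ-+ 1 (length xs)) ⟩
    (1ℚ ℚ.+ toℚ (length xs)) ℚ.* q     ≡⟨ ℚ.*-distribʳ-+ q 1ℚ (toℚ (length xs)) ⟩
    1ℚ ℚ.* q ℚ.+ toℚ (length xs) ℚ.* q ≡⟨ cong₂ ℚ._+_ (ℚ.*-identityˡ q) (sym (∑-const q xs)) ⟩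
    q ℚ.+ ∑ (λ _ → q) xs               ∎)
    where open ≡-Reasoning

  ∑-nonpos : ∀ {f : X → ℚ} xs → (∀ {x} → x ∈ xs → f x ℚ.≤ 0ℚ) → ∑ f xs ℚ.≤ 0ℚ
  ∑-nonpos xs le = ℚ.≤-trans (∑-mono-≤ xs le)
    (ℚ.≤-reflexive (trans (∑-const 0ℚ xs) (ℚ.*-zeroʳ (toℚ (length xs)))))

  ∑-filter : ∀ {p} {P : Pred X p} (P? : Decidable P) (f : X → ℚ) xs →
             ∑ f xs ≡ ∑ f (filter P? xs) ℚ.+ ∑ f (filter (¬? ∘ P?) xs)
  ∑-filter P? f [] = refl
  ∑-filter P? f (x ∷ xs) with does (P? x)
  ... | true  = trans (cong (f x ℚ.+_) (∑-filter P? f xs)) (sym (ℚ.+-assoc (f x) _ _))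
  ... | false = trans (cong (f x ℚ.+_) (∑-filter P? f xs))
                      (ℚ+.x∙yz≈y∙xz (f x) (∑ f (filter P? xs)) (∑ f (filter (¬? ∘ P?) xs)))

∑-concatMap : ∀ {a b} {X : Set a} {Y : Set b} (g : Y → ℚ) (F : X → List Y) xs →
              ∑ g (List.concatMap F xs) ≡ ∑ (∑ g ∘ F) xs
∑-concatMap g F [] = refl
∑-concatMap g F (x ∷ xs) = trans (∑-++ g (F x) (List.concatMap F xs)) (cong (∑ g (F x) ℚ.+_) (∑-concatMap g F xs))

δ : ∀ {m} → Vec Bool m → ℚ → Vec Bool m → ℚ
δ v q w = if does (v ≟v w) then q else 0ℚ

∑-allBits-δ : ∀ m (v : Vec Bool m) q → ∑ (δ v q) (allBits m) ≡ q
∑-allBits-δ zero [] q = ℚ.+-identityʳ q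
∑-allBits-δ (suc m) (x ∷ v) q = begin
  ∑ (δ (x ∷ v) q) (allBits (suc m)) ≡⟨ ∑-concatMap (δ (x ∷ v) q) _ (allBits m) ⟩
  ∑ (λ w → δ (x ∷ v) q (false ∷ w) ℚ.+ (δ (x ∷ v) q (true ∷ w) ℚ.+ 0ℚ)) (allBits m)
                                     ≡⟨ ∑-cong (allBits m) (λ {w} _ → cons x w) ⟩
  ∑ (δ v q) (allBits m)              ≡⟨ ∑-allBits-δ m v q ⟩
  q                                  ∎
  where
  open ≡-Reasoning
  cons : ∀ x w → δ (x ∷ v) q (false ∷ w) ℚ.+ (δ (x ∷ v) q (true ∷ w) ℚ.+ 0ℚ) ≡ δ v q w
  cons false w with does (v ≟v w)
  ... | true  = trans (cong (q ℚ.+_) (ℚ.+-identityʳ 0ℚ)) (ℚ.+-identityʳ q)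
  ... | false = refl
  cons true w with does (v ≟v w)
  ... | true  = trans (ℚ.+-identityˡ _) (ℚ.+-identityʳ q)
  ... | false = refl

∑-group-by : ∀ {a} {X : Set a} {m} (key : X → Vec Bool m) (f : X → ℚ) xs →
  ∑ (λ v → ∑ f (filter (λ x → key x ≟v v) xs)) (allBits m) ≡ ∑ f xs
∑-group-by {m = m} key f [] = trans (∑-const 0ℚ (allBits m)) (ℚ.*-zeroʳ (toℚ (length (allBits m))))
∑-group-by {m = m} key f (x ∷ xs) = begin
  ∑ (λ v → ∑ f (filter (λ y → key y ≟v v) (x ∷ xs))) (allBits m)
    ≡⟨ ∑-cong (allBits m) (λ {v} _ → head-term v) ⟩
  ∑ (λ v → δ (key x) (f x) v ℚ.+ ∑ f (filter (λ y → key y ≟v v) xs)) (allBits m)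
    ≡⟨ ∑-+ (δ (key x) (f x)) _ (allBits m) ⟩
  ∑ (δ (key x) (f x)) (allBits m) ℚ.+ ∑ (λ v → ∑ f (filter (λ y → key y ≟v v) xs)) (allBits m)
    ≡⟨ cong₂ ℚ._+_ (∑-allBits-δ m (key x) (f x)) (∑-group-by key f xs) ⟩
  f x ℚ.+ ∑ f xs ∎
  where
  open ≡-Reasoning
  head-term : ∀ v → ∑ f (filter (λ y → key y ≟v v) (x ∷ xs))
                  ≡ δ (key x) (f x) v ℚ.+ ∑ f (filter (λ y → key y ≟v v) xs)
  head-term v with does (key x ≟v v)
  ... | true  = refl
  ... | false = sym (ℚ.+-identityˡ _)

-- Hamming distance

module _ where
  private
    variable m : ℕ

    differ : Bool → Bool → ℕ
    differ a b = if a xor b then 1 else 0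

  dist-self : (x : Point m) → dist x x ≡ 0
  dist-self [] = refl
  dist-self (false ∷ x) = dist-self x
  dist-self (true ∷ x) = dist-self x

  dist-sym : (x y : Point m) → dist x y ≡ dist y x
  dist-sym [] [] = refl
  dist-sym (a ∷ x) (b ∷ y) = cong₂ _+_ (differ-sym a b) (dist-sym x y)
    where
    differ-sym : ∀ a b → differ a b ≡ differ b a
    differ-sym false false = refl
    differ-sym false true  = refl
    differ-sym true  false = refl
    differ-sym true  true  = refl

  dist-triangle : (x y z : Point m) → dist x z ≤ dist x y + dist y z
  dist-triangle [] [] [] = z≤n
  dist-triangle (a ∷ x) (b ∷ y) (c ∷ z) = ℕ.≤-trans
    (ℕ.+-mono-≤ (differ-triangle a b c) (dist-triangle x y z))
    (ℕ.≤-reflexive (ℕ+.interchange (differ a b) (differ b c) (dist x y) (dist y z)))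
    where
    differ-triangle : ∀ a b c → differ a c ≤ differ a b + differ b c
    differ-triangle false false false = z≤n
    differ-triangle false false true  = s≤s z≤n
    differ-triangle false true  false = z≤n
    differ-triangle false true  true  = s≤s z≤n
    differ-triangle true  false false = s≤s z≤n
    differ-triangle true  false true  = z≤n
    differ-triangle true  true  false = s≤s z≤n
    differ-triangle true  true  true  = z≤n

  ∑-dist-triangle : (x y : Point m) (C : List (Point m)) →
                    length C * dist x y ≤ ∑ℕ (dist x) C + ∑ℕ (dist y) C
  ∑-dist-triangle x y [] = z≤n
  ∑-dist-triangle x y (c ∷ C) = ℕ.≤-trans
    (ℕ.+-mono-≤ via-c (∑-dist-triangle x y C))
    (ℕ.≤-reflexive (ℕ+.interchange (dist x c) (dist y c) (∑ℕ (dist x) C) (∑ℕ (dist y) C)))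
    where
    via-c : dist x y ≤ dist x c + dist y c
    via-c = subst (λ d → dist x y ≤ dist x c + d) (dist-sym c y) (dist-triangle x c y)

  ∑-∑-dist-triangle : (x : Point m) (Cu Cv : List (Point m)) →
    length Cv * ∑ℕ (dist x) Cu ≤ length Cu * ∑ℕ (dist x) Cv + ∑ℕ (λ c → ∑ℕ (dist c) Cv) Cu
  ∑-∑-dist-triangle x [] Cv = ℕ.≤-reflexive (ℕ.*-zeroʳ (length Cv))
  ∑-∑-dist-triangle x (c ∷ Cu) Cv = ℕ.≤-trans
    (ℕ.≤-reflexive (ℕ.*-distribˡ-+ (length Cv) (dist x c) _))
    (ℕ.≤-trans (ℕ.+-mono-≤ (∑-dist-triangle x c Cv) (∑-∑-dist-triangle x Cu Cv))
      (ℕ.≤-reflexive (ℕ+.interchange (∑ℕ (dist x) Cv) (∑ℕ (dist c) Cv) _ _)))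

  meanDist : List (Point m) → Point m → ℚ
  meanDist C x = divℚ (∑ℕ (dist x) C) (length C)

  meanDist-≤-avg-+ : (x : Point m) (Cu Cv : List (Point m)) → x ∈ Cu → x ∈ Cv →
                     meanDist Cu x ℚ.≤ avg Cu Cv ℚ.+ meanDist Cv x
  meanDist-≤-avg-+ x Cu@(_ ∷ Cu′) Cv@(_ ∷ Cv′) _ _ =
    divℚ-≤-+ (∑ℕ (dist x) Cu) (∑ℕ (dist x) Cv) (∑ℕ (λ c → ∑ℕ (dist c) Cv) Cu) (length Cu′) (length Cv′)
      (∑-∑-dist-triangle x Cu Cv)

  dist-≤-meanDist-+ : (x y : Point m) (C : List (Point m)) → x ∈ C →
                      toℚ (dist x y) ℚ.≤ meanDist C x ℚ.+ meanDist C y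
  dist-≤-meanDist-+ x y C@(_ ∷ C′) _ = toℚ-≤-divℚ-+ (dist x y) (∑ℕ (dist x) C) (∑ℕ (dist y) C) (length C′)
    (∑-dist-triangle x y C)

  meanDist-concentrated : (x : Point m) (C : List (Point m)) → (∀ {c} → c ∈ C → c ≡ x) →
                          meanDist C x ℚ.≤ 0ℚ
  meanDist-concentrated x C eq = subst (λ s → divℚ s (length C) ℚ.≤ 0ℚ) (sym (∑-zero C eq)) (divℚ-zero (length C))
    where
    ∑-zero : ∀ C → (∀ {c} → c ∈ C → c ≡ x) → ∑ℕ (dist x) C ≡ 0
    ∑-zero [] eq = refl
    ∑-zero (c ∷ C) eq = cong₂ _+_ (trans (cong (dist x) (eq (here refl))) (dist-self x)) (∑-zero C (eq ∘′ there))

-- Lowest common ancestors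

module _ {k : ℕ} where

  lcaT-node-≡ : ∀ {j r} ℓ (f : Vec Bool (2 ^ j) → Tree k (suc j) (suc r)) {x y} → sel ℓ x ≡ sel ℓ y →
                lcaT (node ℓ f) x y ≡ suc (lcaT (f (sel ℓ x)) x y)
  lcaT-node-≡ ℓ f {x} {y} eq with sel ℓ x ≟v sel ℓ y
  ... | yes _  = refl
  ... | no neq = contradiction eq neq

  lcaT-node-≢ : ∀ {j r} ℓ (f : Vec Bool (2 ^ j) → Tree k (suc j) (suc r)) {x y} → sel ℓ x ≢ sel ℓ y →
                lcaT (node ℓ f) x y ≡ 0
  lcaT-node-≢ ℓ f {x} {y} neq with sel ℓ x ≟v sel ℓ y
  ... | yes eq = contradiction eq neq
  ... | no _   = refl

  lcaT-last-≡ : ∀ {x y} → sel (lastLabel k) x ≡ sel (lastLabel k) y → lcaT {k} last x y ≡ 1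
  lcaT-last-≡ {x} {y} eq with sel (lastLabel k) x ≟v sel (lastLabel k) y
  ... | yes _  = refl
  ... | no neq = contradiction eq neq

  lcaT-last-≢ : ∀ {x y} → sel (lastLabel k) x ≢ sel (lastLabel k) y → lcaT {k} last x y ≡ 0
  lcaT-last-≢ {x} {y} neq with sel (lastLabel k) x ≟v sel (lastLabel k) y
  ... | yes eq = contradiction eq neq
  ... | no _   = refl

  lcaT-sym : ∀ {j r} (t : Tree k j r) x y → lcaT t x y ≡ lcaT t y x
  lcaT-sym last x y with sel (lastLabel k) x ≟v sel (lastLabel k) y
  ... | yes eq  = sym (lcaT-last-≡ (sym eq))
  ... | no  neq = sym (lcaT-last-≢ (neq ∘′ sym))
  lcaT-sym (node ℓ f) x y with sel ℓ x ≟v sel ℓ y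
  ... | yes eq  = sym (trans (lcaT-node-≡ ℓ f (sym eq))
                        (cong suc (trans (cong (λ v → lcaT (f v) y x) (sym eq)) (lcaT-sym (f (sel ℓ x)) y x))))
  ... | no  neq = sym (lcaT-node-≢ ℓ f (neq ∘′ sym))

  lcaT-ultra : ∀ {j r} (t : Tree k j r) x y z c → c ≤ lcaT t x y → c ≤ lcaT t y z → c ≤ lcaT t x z
  lcaT-ultra t x y z zero _ _ = z≤n
  lcaT-ultra last x y z (suc c) c≤xy c≤yz
    with sel (lastLabel k) x ≟v sel (lastLabel k) y | sel (lastLabel k) y ≟v sel (lastLabel k) z
  ... | yes eq₁ | yes eq₂ = subst (suc c ≤_) (sym (lcaT-last-≡ (trans eq₁ eq₂))) c≤xy
  ... | no _    | _       = contradiction c≤xy λ ()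
  ... | yes _   | no _    = contradiction c≤yz λ ()
  lcaT-ultra (node ℓ f) x y z (suc c) c≤xy c≤yz with sel ℓ x ≟v sel ℓ y | sel ℓ y ≟v sel ℓ z
  ... | yes eq₁ | yes eq₂ = subst (suc c ≤_) (sym (lcaT-node-≡ ℓ f (trans eq₁ eq₂)))
          (s≤s (lcaT-ultra (f (sel ℓ x)) x y z c (ℕ.≤-pred c≤xy)
                 (subst (λ v → c ≤ lcaT (f v) y z) (sym eq₁) (ℕ.≤-pred c≤yz))))
  ... | no _    | _       = contradiction c≤xy λ ()
  ... | yes _   | no _    = contradiction c≤yz λ ()

  lcaT-ultra₄ : ∀ {j r} (t : Tree k j r) {a a′ b b′} c → c ≤ lcaT t a b → c ≤ lcaT t a′ b′ → c ≤ lcaT t a b′ →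
                c ≤ lcaT t a′ b
  lcaT-ultra₄ t {a} {a′} {b} {b′} c c≤ab c≤a′b′ c≤ab′ =
    lcaT-ultra t a′ a b c (lcaT-ultra t a′ b′ a c c≤a′b′ (subst (c ≤_) (lcaT-sym t a b′) c≤ab′)) c≤ab

  lcaT-exchange : ∀ {j r} (t : Tree k j r) {D a a′ b b′} → D ≤ lcaT t a b′ → lcaT t a b < D → lcaT t a′ b′ < D →
                  lcaT t a b + lcaT t a′ b′ < lcaT t a b′ + lcaT t a′ b
  lcaT-exchange t {D} {a} {a′} {b} {b′} D≤ab′ ab<D a′b′<D with ℕ.≤-total (lcaT t a b) (lcaT t a′ b′)
  ... | inj₁ ab≤a′b′ = subst (lcaT t a b + lcaT t a′ b′ <_) (ℕ.+-comm (lcaT t a′ b) (lcaT t a b′))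
        (ℕ.+-mono-≤-< (lcaT-ultra₄ t _ ℕ.≤-refl ab≤a′b′ (ℕ.≤-trans (ℕ.<⇒≤ ab<D) D≤ab′))
                      (ℕ.<-≤-trans a′b′<D D≤ab′))
  ... | inj₂ a′b′≤ab = ℕ.+-mono-<-≤ (ℕ.<-≤-trans ab<D D≤ab′)
        (lcaT-ultra₄ t _ a′b′≤ab ℕ.≤-refl (ℕ.≤-trans (ℕ.<⇒≤ a′b′<D) D≤ab′))

-- Transposing partners in a matching

module _ {n : ℕ} where

  transpose-i : (i j : Fin n) → PC.transpose i j i ≡ j
  transpose-i i j with i Fin.≟ i
  ... | yes _  = refl
  ... | no i≢i = contradiction refl i≢i

  transpose-j : (i j : Fin n) → PC.transpose i j j ≡ i
  transpose-j i j with j Fin.≟ i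
  ... | yes j≡i = j≡i
  ... | no _ with j Fin.≟ j
  ...   | yes _  = refl
  ...   | no j≢j = contradiction refl j≢j

  transpose-other : (i j m : Fin n) → m ≢ i → m ≢ j → PC.transpose i j m ≡ m
  transpose-other i j m m≢i m≢j with m Fin.≟ i
  ... | yes m≡i = contradiction m≡i m≢i
  ... | no _ with m Fin.≟ j
  ...   | yes m≡j = contradiction m≡j m≢j
  ...   | no _    = refl

∑-update : ∀ {n} (f g : Fin n → ℕ) i → (∀ m → m ≢ i → f m ≡ g m) → sum f + g i ≡ sum g + f i
∑-update {suc n} f g i agree = begin
  sum f + g i                           ≡⟨ cong (_+ g i) (sum-remove {i = i} f) ⟩
  f i + sum (f ∘ Fin.punchIn i) + g i   ≡⟨ cong (λ s → f i + s + g i)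
                                             (sum-cong-≗ λ m → agree _ (Fin.punchInᵢ≢i i m)) ⟩
  f i + sum (g ∘ Fin.punchIn i) + g i   ≡⟨ ℕ+.xy∙z≈zy∙x (f i) _ (g i) ⟩
  g i + sum (g ∘ Fin.punchIn i) + f i   ≡⟨ cong (_+ f i) (sym (sum-remove {i = i} g)) ⟩
  sum g + f i                           ∎
  where open ≡-Reasoning

module _ {n : ℕ} (w : Fin n → Fin n → ℕ) where

  score : Permutation′ n → ℕ
  score σ = sum (λ i → w i (σ ⟨$⟩ʳ i))

  score-transpose : ∀ σ {i j} → i ≢ j →
    score σ + (w i (σ ⟨$⟩ʳ j) + w j (σ ⟨$⟩ʳ i))
      ≡ score (transpose i j ∘ₚ σ) + (w i (σ ⟨$⟩ʳ i) + w j (σ ⟨$⟩ʳ j))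
  score-transpose σ {i} {j} i≢j = begin
    sum f + (w i (σ ⟨$⟩ʳ j) + w j (σ ⟨$⟩ʳ i)) ≡⟨ sym (ℕ.+-assoc (sum f) _ _) ⟩
    sum f + w i (σ ⟨$⟩ʳ j) + w j (σ ⟨$⟩ʳ i)   ≡⟨ cong (λ x → sum f + x + w j (σ ⟨$⟩ʳ i)) (sym h-i) ⟩
    sum f + h i + w j (σ ⟨$⟩ʳ i)              ≡⟨ cong (_+ w j (σ ⟨$⟩ʳ i)) (∑-update f h i f≗h-off-i) ⟩
    sum h + f i + w j (σ ⟨$⟩ʳ i)              ≡⟨ ℕ+.xy∙z≈xz∙y (sum h) (f i) _ ⟩
    sum h + w j (σ ⟨$⟩ʳ i) + f i              ≡⟨ cong (λ x → sum h + x + f i) (sym g-j) ⟩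
    sum h + g j + f i                         ≡⟨ cong (_+ f i) (∑-update h g j h≗g-off-j) ⟩
    sum g + h j + f i                         ≡⟨ cong (λ x → sum g + x + f i) (updateAt-minimal j i f (i≢j ∘′ sym)) ⟩
    sum g + f j + f i                         ≡⟨ ℕ+.xy∙z≈x∙zy (sum g) (f j) (f i) ⟩
    sum g + (f i + f j)                       ∎
    where
    open ≡-Reasoning
    f g h : Fin n → ℕ
    f m = w m (σ ⟨$⟩ʳ m)
    g m = w m (σ ⟨$⟩ʳ PC.transpose i j m)
    h = updateAt f i (λ _ → w i (σ ⟨$⟩ʳ j))
    h-i : h i ≡ w i (σ ⟨$⟩ʳ j)
    h-i = updateAt-updates i f
    g-j : g j ≡ w j (σ ⟨$⟩ʳ i)
    g-j = cong (λ m → w j (σ ⟨$⟩ʳ m)) (transpose-j i j)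
    f≗h-off-i : ∀ m → m ≢ i → f m ≡ h m
    f≗h-off-i m m≢i = sym (updateAt-minimal m i f m≢i)
    h≗g-off-j : ∀ m → m ≢ j → h m ≡ g m
    h≗g-off-j m m≢j = by-cases (m Fin.≟ i)
      where
      by-cases : Dec (m ≡ i) → h m ≡ g m
      by-cases (yes m≡i) = subst (λ x → h x ≡ g x) (sym m≡i)
                             (trans h-i (cong (λ m′ → w i (σ ⟨$⟩ʳ m′)) (sym (transpose-i i j))))
      by-cases (no m≢i)  = trans (updateAt-minimal m i f m≢i)
                             (cong (λ m′ → w m (σ ⟨$⟩ʳ m′)) (sym (transpose-other i j m m≢i m≢j)))

module _ {a} {X : Set a} where

  filter-map : ∀ {b p} {Y : Set b} {P : Pred Y p} (P? : Decidable P) (f : X → Y) xs →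
               filter P? (List.map f xs) ≡ List.map f (filter (P? ∘ f) xs)
  filter-map P? f [] = refl
  filter-map P? f (x ∷ xs) with does (P? (f x))
  ... | true  = cong (f x ∷_) (filter-map P? f xs)
  ... | false = filter-map P? f xs

  ↭-filter-partition : ∀ {p} {P : Pred X p} (P? : Decidable P) xs → xs ↭ filter P? xs ++ filter (¬? ∘ P?) xs
  ↭-filter-partition P? [] = ↭-refl
  ↭-filter-partition P? (x ∷ xs) with P? x
  ... | yes _ = prep x (↭-filter-partition P? xs)
  ... | no _  = ↭-trans (prep x (↭-filter-partition P? xs)) (↭-sym (↭.shift x (filter P? xs) _))

  filter-cong-∈ : ∀ {p q} {P : Pred X p} {Q : Pred X q} (P? : Decidable P) (Q? : Decidable Q) xs →
                  (∀ {x} → x ∈ xs → does (P? x) ≡ does (Q? x)) → filter P? xs ≡ filter Q? xs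
  filter-cong-∈ P? Q? [] agree = refl
  filter-cong-∈ P? Q? (x ∷ xs) agree with P? x | Q? x | agree (here refl)
  ... | yes _ | yes _ | _  = cong (x ∷_) (filter-cong-∈ P? Q? xs (agree ∘′ there))
  ... | no _  | no _  | _  = filter-cong-∈ P? Q? xs (agree ∘′ there)
  ... | yes _ | no _  | ()
  ... | no _  | yes _ | ()

  incompatible⇒empty : ∀ {b} {Y : Set b} (xs : List X) (ys : List Y) → (∀ {x y} → x ∈ xs → y ∈ ys → ⊥) →
                       xs ≡ [] ⊎ ys ≡ []
  incompatible⇒empty [] ys _ = inj₁ refl
  incompatible⇒empty (x ∷ xs) [] _ = inj₂ refl
  incompatible⇒empty (x ∷ xs) (y ∷ ys) incompatible = ⊥-elim (incompatible (here refl) (here refl))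

  length-↭-map-++ : ∀ {b} {Y : Set b} {ys : List Y} (f : X → Y) xs xs′ → ys ↭ List.map f (xs ++ xs′) →
                    length ys ≡ length xs + length xs′
  length-↭-map-++ f xs xs′ ys↭ = trans (↭.↭-length ys↭) (trans (List.length-map f (xs ++ xs′)) (List.length-++ xs))

∣p+x-p+y∣ : ∀ p x y → x ≡ 0 ⊎ y ≡ 0 → ℕ.∣ p + x - p + y ∣ ≡ x + y
∣p+x-p+y∣ p x y one-zero = trans (ℕ.∣m+n-m+o∣≡∣n-o∣ p x y) (on-zero one-zero)
  where
  on-zero : x ≡ 0 ⊎ y ≡ 0 → ℕ.∣ x - y ∣ ≡ x + y
  on-zero (inj₁ refl) = ℕ.∣-∣-identityˡ y
  on-zero (inj₂ refl) = trans (ℕ.∣-∣-identityʳ x) (sym (ℕ.+-identityʳ x))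

sum-allFin : ∀ {n} (f : Fin n → ℕ) → Vec.sum (Vec.map f (Vec.allFin n)) ≡ sum f
sum-allFin {n} f = trans (cong Vec.sum (sym (Vec.tabulate-∘ f (λ i → i)))) (sum-tabulate n f)
  where
  sum-tabulate : ∀ n (f : Fin n → ℕ) → Vec.sum (Vec.tabulate f) ≡ sum f
  sum-tabulate zero f = refl
  sum-tabulate (suc n) f = cong (f Fin.zero +_) (sum-tabulate n (f ∘ Fin.suc))

toList≡tabulate-lookup : ∀ {a} {X : Set a} {n} (xs : Vec X n) → Vec.toList xs ≡ List.tabulate (Vec.lookup xs)
toList≡tabulate-lookup [] = refl
toList≡tabulate-lookup (x ∷ xs) = cong (x ∷_) (toList≡tabulate-lookup xs)

tabulate-↭-permute : ∀ {a} {X : Set a} {n} (g : Fin n → X) (π : Permutation′ n) →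
                     List.tabulate g ↭ List.tabulate (g ∘ (π ⟨$⟩ʳ_))
tabulate-↭-permute {X = X} g π =
  subst₂ _↭_ (singletons g) (singletons (g ∘ (π ⟨$⟩ʳ_))) (++-sum-permute (λ i → List.[ g i ]) π)
  where
  -- Lists up to ↭ form a commutative monoid, and sums in it are invariant under permuting the summands.
  open import Algebra.Properties.CommutativeMonoid.Sum (↭.++-commutativeMonoid {A = X})
    using () renaming (sum to concat; sum-permute to ++-sum-permute)
  singletons : ∀ {n} (g : Fin n → X) → concat (λ i → List.[ g i ]) ≡ List.tabulate g
  singletons {zero} g = refl
  singletons {suc n} g = cong (g Fin.zero ∷_) (singletons (g ∘ Fin.suc))

toℚ-sum : ∀ {n} (f : Fin n → ℕ) → toℚ (sum f) ≡ ∑ (toℚ ∘ f) (List.allFin n)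
toℚ-sum {n} f = trans (tabulated f) (cong sumℚ (sym (List.map-tabulate (λ i → i) (toℚ ∘ f))))
  where
  tabulated : ∀ {n} (f : Fin n → ℕ) → toℚ (sum f) ≡ sumℚ (List.tabulate (toℚ ∘ f))
  tabulated {zero} f = refl
  tabulated {suc n} f = trans (toℚ-+ (f Fin.zero) _) (cong (toℚ (f Fin.zero) ℚ.+_) (tabulated (f ∘ Fin.suc)))

-- The potential

module _ {k n : ℕ} (T : Quadtree k) (A B : Vec (Point (2 ^ k)) n) (σ : Permutation′ n)
         (optimal : IsOptimal T A B σ) where

  private
    Pt : Set
    Pt = Point (2 ^ k)

  a b : Fin n → Pt
  a i = Vec.lookup A i
  b i = Vec.lookup B (σ ⟨$⟩ʳ i)

  lc : Pt → Pt → ℕ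
  lc = lcaT T

  matchCost : Fin n → ℚ
  matchCost i = toℚ (dist (a i) (b i))

  no-crossing : ∀ {D i j} → D ≤ lc (a i) (b j) → lc (a i) (b i) < D → lc (a j) (b j) < D → ⊥
  no-crossing {D} {i} {j} D≤aᵢbⱼ aᵢbᵢ<D aⱼbⱼ<D = ℕ.<⇒≱ σ<τ τ≤σ
    where
    w : Fin n → Fin n → ℕ
    w i j = lc (Vec.lookup A i) (Vec.lookup B j)
    τ : Permutation′ n
    τ = transpose i j ∘ₚ σ
    i≢j : i ≢ j
    i≢j refl = ℕ.<⇒≱ aᵢbᵢ<D D≤aᵢbⱼ
    τ≤σ : score w τ ≤ score w σ
    τ≤σ = subst₂ _≤_ (sum-allFin (λ m → w m (τ ⟨$⟩ʳ m))) (sum-allFin (λ m → w m (σ ⟨$⟩ʳ m))) (optimal τ)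
    crossed : ℕ
    crossed = lc (a i) (b j) + lc (a j) (b i)
    σ<τ : score w σ < score w τ
    σ<τ = ℕ.+-cancelʳ-< crossed (score w σ) (score w τ)
      (subst (_< score w τ + crossed) (sym (score-transpose w σ i≢j))
        (ℕ.+-monoʳ-< (score w τ) (lcaT-exchange T D≤aᵢbⱼ aᵢbᵢ<D aⱼbⱼ<D)))

  -- The matching seen from a subtree rooted at depth D whose points are those satisfying U: its points Au, Bu
  -- are the pairs matched inside it and the points whose partner lies outside (so they meet above depth D).
  record Cell (D : ℕ) (U : Pt → Set) (Au Bu : List Pt) : Set where
    field
      paired unpairedA unpairedB : List (Fin n)
      A-↭ : Au ↭ List.map a (paired ++ unpairedA)
      B-↭ : Bu ↭ List.map b (paired ++ unpairedB)
      paired-in    : ∀ {i} → i ∈ paired → U (a i) × U (b i)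
      unpairedA-in : ∀ {i} → i ∈ unpairedA → U (a i) × lc (a i) (b i) < D
      unpairedB-in : ∀ {i} → i ∈ unpairedB → U (b i) × lc (a i) (b i) < D

    a∈Au : ∀ {i} → i ∈ paired ++ unpairedA → a i ∈ Au
    a∈Au i∈ = ↭.∈-resp-↭ (↭-sym A-↭) (∈-map⁺ a i∈)

    b∈Bu : ∀ {i} → i ∈ paired ++ unpairedB → b i ∈ Bu
    b∈Bu i∈ = ↭.∈-resp-↭ (↭-sym B-↭) (∈-map⁺ b i∈)

    potential : ℚ
    potential = ∑ matchCost paired
      ℚ.+ (∑ (meanDist (Au ++ Bu) ∘ a) unpairedA ℚ.+ ∑ (meanDist (Au ++ Bu) ∘ b) unpairedB)

    potential-concentrated : ∀ z → (∀ {x} → x ∈ Au ++ Bu → x ≡ z) → potential ℚ.≤ 0ℚ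
    potential-concentrated z at-z =
      ℚ.+-mono-≤ (∑-nonpos paired (λ i∈ → ℚ.≤-reflexive (cong toℚ (same-point i∈))))
        (ℚ.+-mono-≤ (∑-nonpos unpairedA λ {i} i∈ →
                        meanDist-concentrated (a i) (Au ++ Bu) λ x∈ → trans (at-z x∈) (sym (at-z (aᵢ∈ i∈))))
                    (∑-nonpos unpairedB λ {i} i∈ →
                        meanDist-concentrated (b i) (Au ++ Bu) λ x∈ → trans (at-z x∈) (sym (at-z (bᵢ∈ i∈)))))
      where
      aᵢ∈ : ∀ {i} → i ∈ unpairedA → a i ∈ Au ++ Bu
      aᵢ∈ i∈ = ∈-++⁺ˡ (a∈Au (∈-++⁺ʳ paired i∈))
      bᵢ∈ : ∀ {i} → i ∈ unpairedB → b i ∈ Au ++ Bu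
      bᵢ∈ i∈ = ∈-++⁺ʳ Au (b∈Bu (∈-++⁺ʳ paired i∈))
      same-point : ∀ {i} → i ∈ paired → dist (a i) (b i) ≡ 0
      same-point {i} i∈ = trans (cong₂ dist (at-z (∈-++⁺ˡ (a∈Au (∈-++⁺ˡ i∈))))
                                            (at-z (∈-++⁺ʳ Au (b∈Bu (∈-++⁺ˡ i∈)))))
                                (dist-self z)

  module Split {l D} {U : Pt → Set} {Au Bu : List Pt} (ℓ : Vec (Fin (2 ^ k)) l) (c : Cell D U Au Bu)
    (deep    : ∀ {x y} → U x → U y → sel ℓ x ≡ sel ℓ y → D < lc x y)
    (shallow : ∀ {x y} → U x → U y → sel ℓ x ≢ sel ℓ y → lc x y ≤ D) where

    open Cell c

    branchA branchB : Fin n → Vec Bool l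
    branchA i = sel ℓ (a i)
    branchB i = sel ℓ (b i)

    unsplit? : Decidable (λ i → branchA i ≡ branchB i)
    unsplit? i = branchA i ≟v branchB i

    kept cut leavingA leavingB : List (Fin n)
    kept = filter unsplit? paired
    cut = filter (¬? ∘ unsplit?) paired
    leavingA = cut ++ unpairedA
    leavingB = cut ++ unpairedB

    at : (Fin n → Vec Bool l) → Vec Bool l → List (Fin n) → List (Fin n)
    at branch v = filter (λ i → branch i ≟v v)

    Cu : List Pt
    Cu = Au ++ Bu

    C : Vec Bool l → List Pt
    C v = goTo ℓ v Au ++ goTo ℓ v Bu

    Uᵥ : Vec Bool l → Pt → Set
    Uᵥ v x = U x × sel ℓ x ≡ v

    regroup : ∀ (e : Fin n → Pt) {X} S v → X ↭ List.map e (paired ++ S) →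
              goTo ℓ v X ↭ List.map e (at (sel ℓ ∘ e) v kept ++ at (sel ℓ ∘ e) v (cut ++ S))
    regroup e {X} S v X↭ = begin
      goTo ℓ v X                                     ↭⟨ ↭.filter-↭ (λ x → sel ℓ x ≟v v) X↭ ⟩
      filter (λ x → sel ℓ x ≟v v) (List.map e (paired ++ S))
                                                     ≡⟨ filter-map (λ x → sel ℓ x ≟v v) e (paired ++ S) ⟩
      List.map e (at (sel ℓ ∘ e) v (paired ++ S))    ↭⟨ ↭.map⁺ e (↭.filter-↭ (λ i → sel ℓ (e i) ≟v v) split) ⟩
      List.map e (at (sel ℓ ∘ e) v (kept ++ (cut ++ S)))
                                                     ≡⟨ cong (List.map e) (List.filter-++ (λ i → sel ℓ (e i) ≟v v) kept _) ⟩
      List.map e (at (sel ℓ ∘ e) v kept ++ at (sel ℓ ∘ e) v (cut ++ S)) ∎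
      where
      open PermutationReasoning
      split : paired ++ S ↭ kept ++ (cut ++ S)
      split = ↭-trans (↭.++⁺ʳ S (↭-filter-partition unsplit? paired)) (↭-reflexive (List.++-assoc kept cut S))

    kept-at-branchB : ∀ v → at branchB v kept ≡ at branchA v kept
    kept-at-branchB v = filter-cong-∈ (λ i → branchB i ≟v v) (λ i → branchA i ≟v v) kept
      λ i∈ → cong (λ w → does (w ≟v v)) (sym (proj₂ (∈-filter⁻ unsplit? {xs = paired} i∈)))

    leavingA-in : ∀ {i} → i ∈ leavingA → U (a i) × lc (a i) (b i) < suc D
    leavingA-in i∈ with ∈-++⁻ cut i∈
    ... | inj₁ i∈cut = let i∈p , split = ∈-filter⁻ (¬? ∘ unsplit?) {xs = paired} i∈cut
                           Uaᵢ , Ubᵢ = paired-in i∈p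
                       in Uaᵢ , s≤s (shallow Uaᵢ Ubᵢ split)
    ... | inj₂ i∈u   = let Uaᵢ , lt = unpairedA-in i∈u in Uaᵢ , ℕ.m<n⇒m<1+n lt

    leavingB-in : ∀ {i} → i ∈ leavingB → U (b i) × lc (a i) (b i) < suc D
    leavingB-in i∈ with ∈-++⁻ cut i∈
    ... | inj₁ i∈cut = let i∈p , split = ∈-filter⁻ (¬? ∘ unsplit?) {xs = paired} i∈cut
                           Uaᵢ , Ubᵢ = paired-in i∈p
                       in Ubᵢ , s≤s (shallow Uaᵢ Ubᵢ split)
    ... | inj₂ i∈u   = let Ubᵢ , lt = unpairedB-in i∈u in Ubᵢ , ℕ.m<n⇒m<1+n lt

    child : ∀ v → Cell (suc D) (Uᵥ v) (goTo ℓ v Au) (goTo ℓ v Bu)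
    child v = record
      { paired    = at branchA v kept
      ; unpairedA = at branchA v leavingA
      ; unpairedB = at branchB v leavingB
      ; A-↭ = regroup a unpairedA v A-↭
      ; B-↭ = subst (λ p → goTo ℓ v Bu ↭ List.map b (p ++ at branchB v leavingB)) (kept-at-branchB v)
                    (regroup b unpairedB v B-↭)
      ; paired-in = λ i∈ →
          let i∈kept , at-v = ∈-filter⁻ (λ i → branchA i ≟v v) {xs = kept} i∈
              i∈p , unsplit = ∈-filter⁻ unsplit? {xs = paired} i∈kept
              Uaᵢ , Ubᵢ = paired-in i∈p
          in (Uaᵢ , at-v) , (Ubᵢ , trans (sym unsplit) at-v)
      ; unpairedA-in = λ i∈ →
          let i∈l , at-v = ∈-filter⁻ (λ i → branchA i ≟v v) {xs = leavingA} i∈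
              Uaᵢ , lt = leavingA-in i∈l
          in (Uaᵢ , at-v) , lt
      ; unpairedB-in = λ i∈ →
          let i∈l , at-v = ∈-filter⁻ (λ i → branchB i ≟v v) {xs = leavingB} i∈
              Ubᵢ , lt = leavingB-in i∈l
          in (Ubᵢ , at-v) , lt
      }

    -- This is where optimality enters: no child has both A- and B-points leaving through its parent edge.
    one-sided : ∀ v → at branchA v leavingA ≡ [] ⊎ at branchB v leavingB ≡ []
    one-sided v = incompatible⇒empty (at branchA v leavingA) (at branchB v leavingB) λ i∈ j∈ →
      let i∈l , aᵢ-at-v = ∈-filter⁻ (λ i → branchA i ≟v v) {xs = leavingA} i∈
          j∈l , bⱼ-at-v = ∈-filter⁻ (λ i → branchB i ≟v v) {xs = leavingB} j∈
          Uaᵢ , aᵢbᵢ<D = leavingA-in i∈l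
          Ubⱼ , aⱼbⱼ<D = leavingB-in j∈l
      in no-crossing (deep Uaᵢ Ubⱼ (trans aᵢ-at-v (sym bⱼ-at-v))) aᵢbᵢ<D aⱼbⱼ<D

    edgeTerm-child : ∀ v → edgeTerm Au Bu (goTo ℓ v Au) (goTo ℓ v Bu)
                         ≡ ∑ (λ _ → avg Cu (C v)) (at branchA v leavingA)
                           ℚ.+ ∑ (λ _ → avg Cu (C v)) (at branchB v leavingB)
    edgeTerm-child v = begin
      toℚ ℕ.∣ length (goTo ℓ v Au) - length (goTo ℓ v Bu) ∣ ℚ.* avg Cu (C v)
        ≡⟨ cong (λ d → toℚ d ℚ.* avg Cu (C v)) (trans (cong₂ ℕ.∣_-_∣ lengthA lengthB)
             (∣p+x-p+y∣ (length pᵥ) (length uA) (length uB) (Sum.map (cong length) (cong length) (one-sided v)))) ⟩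
      toℚ (length uA + length uB) ℚ.* avg Cu (C v)
        ≡⟨ cong (ℚ._* avg Cu (C v)) (toℚ-+ (length uA) (length uB)) ⟩
      (toℚ (length uA) ℚ.+ toℚ (length uB)) ℚ.* avg Cu (C v)
        ≡⟨ ℚ.*-distribʳ-+ (avg Cu (C v)) (toℚ (length uA)) (toℚ (length uB)) ⟩
      toℚ (length uA) ℚ.* avg Cu (C v) ℚ.+ toℚ (length uB) ℚ.* avg Cu (C v)
        ≡⟨ sym (cong₂ ℚ._+_ (∑-const (avg Cu (C v)) uA) (∑-const (avg Cu (C v)) uB)) ⟩
      ∑ (λ _ → avg Cu (C v)) uA ℚ.+ ∑ (λ _ → avg Cu (C v)) uB ∎
      where
      open ≡-Reasoning
      open Cell (child v) using () renaming (paired to pᵥ; unpairedA to uA; unpairedB to uB)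
      lengthA : length (goTo ℓ v Au) ≡ length pᵥ + length uA
      lengthA = length-↭-map-++ a pᵥ uA (Cell.A-↭ (child v))
      lengthB : length (goTo ℓ v Bu) ≡ length pᵥ + length uB
      lengthB = length-↭-map-++ b pᵥ uB (Cell.B-↭ (child v))

    viaChild : Pt → ℚ
    viaChild x = avg Cu (C (sel ℓ x)) ℚ.+ meanDist (C (sel ℓ x)) x

    leavingA⊆ : ∀ {i} → i ∈ leavingA → i ∈ paired ++ unpairedA
    leavingA⊆ i∈ with ∈-++⁻ cut i∈
    ... | inj₁ i∈cut = ∈-++⁺ˡ (proj₁ (∈-filter⁻ (¬? ∘ unsplit?) {xs = paired} i∈cut))
    ... | inj₂ i∈u   = ∈-++⁺ʳ paired i∈u

    leavingB⊆ : ∀ {i} → i ∈ leavingB → i ∈ paired ++ unpairedB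
    leavingB⊆ i∈ with ∈-++⁻ cut i∈
    ... | inj₁ i∈cut = ∈-++⁺ˡ (proj₁ (∈-filter⁻ (¬? ∘ unsplit?) {xs = paired} i∈cut))
    ... | inj₂ i∈u   = ∈-++⁺ʳ paired i∈u

    potential-≤-leaving : potential ℚ.≤ ∑ matchCost kept
                                        ℚ.+ (∑ (meanDist Cu ∘ a) leavingA ℚ.+ ∑ (meanDist Cu ∘ b) leavingB)
    potential-≤-leaving = begin
      ∑ matchCost paired ℚ.+ (∑ mA unpairedA ℚ.+ ∑ mB unpairedB)
        ≡⟨ cong (ℚ._+ (∑ mA unpairedA ℚ.+ ∑ mB unpairedB)) (∑-filter unsplit? matchCost paired) ⟩
      (∑ matchCost kept ℚ.+ ∑ matchCost cut) ℚ.+ (∑ mA unpairedA ℚ.+ ∑ mB unpairedB)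
        ≤⟨ ℚ.+-monoˡ-≤ (∑ mA unpairedA ℚ.+ ∑ mB unpairedB) (ℚ.+-monoʳ-≤ (∑ matchCost kept) cut-bound) ⟩
      (∑ matchCost kept ℚ.+ (∑ mA cut ℚ.+ ∑ mB cut)) ℚ.+ (∑ mA unpairedA ℚ.+ ∑ mB unpairedB)
        ≡⟨ ℚ.+-assoc (∑ matchCost kept) _ _ ⟩
      ∑ matchCost kept ℚ.+ ((∑ mA cut ℚ.+ ∑ mB cut) ℚ.+ (∑ mA unpairedA ℚ.+ ∑ mB unpairedB))
        ≡⟨ cong (∑ matchCost kept ℚ.+_) (ℚ+.interchange (∑ mA cut) (∑ mB cut) (∑ mA unpairedA) (∑ mB unpairedB)) ⟩
      ∑ matchCost kept ℚ.+ ((∑ mA cut ℚ.+ ∑ mA unpairedA) ℚ.+ (∑ mB cut ℚ.+ ∑ mB unpairedB))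
        ≡⟨ cong (∑ matchCost kept ℚ.+_) (sym (cong₂ ℚ._+_ (∑-++ mA cut unpairedA) (∑-++ mB cut unpairedB))) ⟩
      ∑ matchCost kept ℚ.+ (∑ mA leavingA ℚ.+ ∑ mB leavingB) ∎
      where
      open ℚ.≤-Reasoning
      mA mB : Fin n → ℚ
      mA = meanDist Cu ∘ a
      mB = meanDist Cu ∘ b
      cut-bound : ∑ matchCost cut ℚ.≤ ∑ mA cut ℚ.+ ∑ mB cut
      cut-bound = ℚ.≤-trans
        (∑-mono-≤ cut λ {i} i∈ →
           dist-≤-meanDist-+ (a i) (b i) Cu
             (∈-++⁺ˡ (a∈Au (∈-++⁺ˡ (proj₁ (∈-filter⁻ (¬? ∘ unsplit?) {xs = paired} i∈))))))
        (ℚ.≤-reflexive (∑-+ mA mB cut))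

    meanDist-≤-viaChild : ∀ {x} → x ∈ Au ⊎ x ∈ Bu → meanDist Cu x ℚ.≤ viaChild x
    meanDist-≤-viaChild {x} (inj₁ x∈Au) = meanDist-≤-avg-+ x Cu (C (sel ℓ x)) (∈-++⁺ˡ x∈Au)
      (∈-++⁺ˡ (∈-filter⁺ (λ y → sel ℓ y ≟v sel ℓ x) x∈Au refl))
    meanDist-≤-viaChild {x} (inj₂ x∈Bu) = meanDist-≤-avg-+ x Cu (C (sel ℓ x)) (∈-++⁺ʳ Au x∈Bu)
      (∈-++⁺ʳ (goTo ℓ (sel ℓ x) Au) (∈-filter⁺ (λ y → sel ℓ y ≟v sel ℓ x) x∈Bu refl))

    potential-≤-viaChild : potential ℚ.≤ ∑ matchCost kept
                                         ℚ.+ (∑ (viaChild ∘ a) leavingA ℚ.+ ∑ (viaChild ∘ b) leavingB)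
    potential-≤-viaChild = ℚ.≤-trans potential-≤-leaving
      (ℚ.+-monoʳ-≤ (∑ matchCost kept)
        (ℚ.+-mono-≤ (∑-mono-≤ leavingA λ i∈ → meanDist-≤-viaChild (inj₁ (a∈Au (leavingA⊆ i∈))))
                    (∑-mono-≤ leavingB λ i∈ → meanDist-≤-viaChild (inj₂ (b∈Bu (leavingB⊆ i∈))))))

    grouped-by-child : ∑ matchCost kept ℚ.+ (∑ (viaChild ∘ a) leavingA ℚ.+ ∑ (viaChild ∘ b) leavingB)
      ≡ ∑ (λ v → ∑ matchCost (at branchA v kept)
                 ℚ.+ (∑ (viaChild ∘ a) (at branchA v leavingA) ℚ.+ ∑ (viaChild ∘ b) (at branchB v leavingB)))
          (allBits l)
    grouped-by-child = sym (trans (∑-+ (λ v → ∑ matchCost (at branchA v kept)) _ (allBits l))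
      (cong₂ ℚ._+_ (∑-group-by branchA matchCost kept)
        (trans (∑-+ (λ v → ∑ (viaChild ∘ a) (at branchA v leavingA)) _ (allBits l))
          (cong₂ ℚ._+_ (∑-group-by branchA (viaChild ∘ a) leavingA) (∑-group-by branchB (viaChild ∘ b) leavingB)))))

    child-share : ∀ v → ∑ matchCost (at branchA v kept)
                          ℚ.+ (∑ (viaChild ∘ a) (at branchA v leavingA) ℚ.+ ∑ (viaChild ∘ b) (at branchB v leavingB))
                      ≡ edgeTerm Au Bu (goTo ℓ v Au) (goTo ℓ v Bu) ℚ.+ Cell.potential (child v)
    child-share v = begin
      p ℚ.+ (∑ (viaChild ∘ a) uA ℚ.+ ∑ (viaChild ∘ b) uB)
        ≡⟨ cong (p ℚ.+_) (cong₂ ℚ._+_ (split-viaChild a uA (λ i∈ → proj₂ (proj₁ (Cell.unpairedA-in (child v) i∈))))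
                                      (split-viaChild b uB (λ i∈ → proj₂ (proj₁ (Cell.unpairedB-in (child v) i∈))))) ⟩
      p ℚ.+ ((edge uA ℚ.+ mean a uA) ℚ.+ (edge uB ℚ.+ mean b uB))
        ≡⟨ cong (p ℚ.+_) (ℚ+.interchange (edge uA) (mean a uA) (edge uB) (mean b uB)) ⟩
      p ℚ.+ ((edge uA ℚ.+ edge uB) ℚ.+ (mean a uA ℚ.+ mean b uB))
        ≡⟨ ℚ+.x∙yz≈y∙xz p (edge uA ℚ.+ edge uB) (mean a uA ℚ.+ mean b uB) ⟩
      (edge uA ℚ.+ edge uB) ℚ.+ (p ℚ.+ (mean a uA ℚ.+ mean b uB))
        ≡⟨ cong (ℚ._+ Cell.potential (child v)) (sym (edgeTerm-child v)) ⟩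
      edgeTerm Au Bu (goTo ℓ v Au) (goTo ℓ v Bu) ℚ.+ Cell.potential (child v) ∎
      where
      open ≡-Reasoning
      open Cell (child v) using () renaming (unpairedA to uA; unpairedB to uB)
      p : ℚ
      p = ∑ matchCost (at branchA v kept)
      edge : List (Fin n) → ℚ
      edge = ∑ (λ _ → avg Cu (C v))
      mean : (Fin n → Pt) → List (Fin n) → ℚ
      mean e = ∑ (meanDist (C v) ∘ e)
      split-viaChild : ∀ e is → (∀ {i} → i ∈ is → sel ℓ (e i) ≡ v) →
                       ∑ (viaChild ∘ e) is ≡ edge is ℚ.+ mean e is
      split-viaChild e is at-v =
        trans (∑-cong is λ i∈ → cong (λ w → avg Cu (C w) ℚ.+ meanDist (C w) (e _)) (at-v i∈))
              (∑-+ (λ _ → avg Cu (C v)) (meanDist (C v) ∘ e) is)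

    potential-≤-children :
      potential ℚ.≤ ∑ (λ v → edgeTerm Au Bu (goTo ℓ v Au) (goTo ℓ v Bu) ℚ.+ Cell.potential (child v)) (allBits l)
    potential-≤-children = ℚ.≤-trans potential-≤-viaChild
      (ℚ.≤-reflexive (trans grouped-by-child (∑-cong (allBits l) λ {v} _ → child-share v)))

  potential-≤-valueT : ∀ {j r} (t : Tree k j r) {D U Au Bu} (c : Cell D U Au Bu) →
                       (∀ {x y} → U x → U y → lc x y ≡ D + lcaT t x y) → Cell.potential c ℚ.≤ valueT t Au Bu
  potential-≤-valueT (node ℓ f) {D} {U} {Au} {Bu} c offset = ℚ.≤-trans S.potential-≤-children
    (∑-mono-≤ (allBits _) λ {v} _ →
      ℚ.+-monoʳ-≤ (edgeTerm Au Bu (goTo ℓ v Au) (goTo ℓ v Bu))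
                  (potential-≤-valueT (f v) (S.child v) (offset-child v)))
    where
    deep : ∀ {x y} → U x → U y → sel ℓ x ≡ sel ℓ y → D < lc x y
    deep Ux Uy eq = subst (D <_) (sym (trans (offset Ux Uy) (cong (D +_) (lcaT-node-≡ ℓ f eq))))
                          (ℕ.m<m+n D (s≤s z≤n))
    shallow : ∀ {x y} → U x → U y → sel ℓ x ≢ sel ℓ y → lc x y ≤ D
    shallow Ux Uy neq =
      ℕ.≤-reflexive (trans (offset Ux Uy) (trans (cong (D +_) (lcaT-node-≢ ℓ f neq)) (ℕ.+-identityʳ D)))
    module S = Split ℓ c deep shallow
    offset-child : ∀ v {x y} → S.Uᵥ v x → S.Uᵥ v y → lc x y ≡ suc D + lcaT (f v) x y
    offset-child v {x} {y} (Ux , x-at-v) (Uy , y-at-v) = begin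
      lc x y                             ≡⟨ offset Ux Uy ⟩
      D + lcaT (node ℓ f) x y            ≡⟨ cong (D +_) (lcaT-node-≡ ℓ f (trans x-at-v (sym y-at-v))) ⟩
      D + suc (lcaT (f (sel ℓ x)) x y)   ≡⟨ ℕ.+-suc D _ ⟩
      suc D + lcaT (f (sel ℓ x)) x y     ≡⟨ cong (λ w → suc D + lcaT (f w) x y) x-at-v ⟩
      suc D + lcaT (f v) x y             ∎
      where open ≡-Reasoning
  potential-≤-valueT last {D} {U} {Au} {Bu} c offset = ℚ.≤-trans S.potential-≤-children
    (∑-mono-≤ (allBits _) λ {v} _ →
      ℚ.≤-trans (ℚ.+-monoʳ-≤ (edge v) (Cell.potential-concentrated (S.child v) v (at-leaf v)))
                (ℚ.≤-reflexive (ℚ.+-identityʳ (edge v))))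
    where
    ℓ = lastLabel k
    edge : Vec Bool (2 ^ k) → ℚ
    edge v = edgeTerm Au Bu (goTo ℓ v Au) (goTo ℓ v Bu)
    deep : ∀ {x y} → U x → U y → sel ℓ x ≡ sel ℓ y → D < lc x y
    deep Ux Uy eq =
      ℕ.≤-reflexive (sym (trans (offset Ux Uy) (trans (cong (D +_) (lcaT-last-≡ eq)) (ℕ.+-comm D 1))))
    shallow : ∀ {x y} → U x → U y → sel ℓ x ≢ sel ℓ y → lc x y ≤ D
    shallow Ux Uy neq =
      ℕ.≤-reflexive (trans (offset Ux Uy) (trans (cong (D +_) (lcaT-last-≢ neq)) (ℕ.+-identityʳ D)))
    module S = Split ℓ c deep shallow
    -- The label (1, …, d) reads off the whole point, so each leaf holds copies of a single point.
    at-leaf : ∀ v {x} → x ∈ S.C v → x ≡ v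
    at-leaf v {x} x∈ = trans (sym (Vec.map-lookup-allFin x)) (sel-at-v (∈-++⁻ (goTo ℓ v Au) x∈))
      where
      sel-at-v : x ∈ goTo ℓ v Au ⊎ x ∈ goTo ℓ v Bu → sel ℓ x ≡ v
      sel-at-v (inj₁ x∈A) = proj₂ (∈-filter⁻ (λ y → sel ℓ y ≟v v) {xs = Au} x∈A)
      sel-at-v (inj₂ x∈B) = proj₂ (∈-filter⁻ (λ y → sel ℓ y ≟v v) {xs = Bu} x∈B)

  root : Cell 0 (λ _ → ⊤) (Vec.toList A) (Vec.toList B)
  root = record
    { paired = List.allFin n
    ; unpairedA = []
    ; unpairedB = []
    ; A-↭ = ↭-reflexive (trans (toList≡tabulate-lookup A) (sym all-indices))
    ; B-↭ = ↭-trans (↭-reflexive (toList≡tabulate-lookup B))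
                    (↭-trans (tabulate-↭-permute (Vec.lookup B) σ) (↭-reflexive (sym all-indices)))
    ; paired-in = λ _ → tt , tt
    ; unpairedA-in = λ ()
    ; unpairedB-in = λ ()
    }
    where
    all-indices : ∀ {e : Fin n → Pt} → List.map e (List.allFin n ++ []) ≡ List.tabulate e
    all-indices {e} = trans (cong (List.map e) (List.++-identityʳ (List.allFin n))) (List.map-tabulate (λ i → i) e)

  Cost≡potential-root : toℚ (Cost A B σ) ≡ Cell.potential root
  Cost≡potential-root = begin
    toℚ (Cost A B σ)                      ≡⟨ cong toℚ (sum-allFin (λ i → dist (a i) (b i))) ⟩
    toℚ (sum (λ i → dist (a i) (b i)))    ≡⟨ toℚ-sum (λ i → dist (a i) (b i)) ⟩
    ∑ matchCost (List.allFin n)           ≡⟨ sym (ℚ.+-identityʳ _) ⟩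
    Cell.potential root                   ∎
    where open ≡-Reasoning

lemma3p4 : (k n : ℕ) (T : Quadtree k) (A B : Vec (Point (2 ^ k)) n)
    (σ : Permutation′ n) → IsOptimal T A B σ → toℚ (Cost A B σ) ℚ.≤ Value T A B
lemma3p4 k n T A B σ optimal = begin
  toℚ (Cost A B σ)                       ≡⟨ Cost≡potential-root T A B σ optimal ⟩
  Cell.potential (root T A B σ optimal)  ≤⟨ potential-≤-valueT T A B σ optimal T (root T A B σ optimal) (λ _ _ → refl) ⟩
  Value T A B                            ∎
  where open ℚ.≤-Reasoning
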